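{- Let $V$ be a finite set of nails, let $g_1, g_2$ be specifications on $V$, and let $h_1, h_2$ be expressions in the variables of $V$ such that $h_1$ solves $g_1$ and $h_2$ solves $g_2$. Suppose that for every $S \subseteq V$ with $g_1(S) = g_2(S) = \mathsf{hang}$, the specifications $g_1$ and $g_2$ separate above $S$. Then $h_1 + h_2$ solves $g_1 \wedge g_2$, and $[h_1,h_2]$ solves $g_1 \vee g_2$.
   Context: Expressions are elements of the free group on the variables (nails) of $V$, written additively: $+$ is the non-commutative group operation, $-x$ the inverse, $0$ the identity. The commutator is $[a,b] = a + b - a - b$. For $S \subseteq V$, $h|_S$ denotes $h$ with every variable in $S$ set to $0$. A specification on $V$ is a monotone function $f : 2^V \to \{\mathsf{hang},\mathsf{fall}\}$ (order $\mathsf{hang} < \mathsf{fall}$; monotone means $S \subseteq S' \Rightarrow f(S) \le f(S')$) with $f(V) = \mathsf{fall}$. An expression $h$ solves $f$ if for every $S \subseteq V$: $h|_S = 0 \iff f(S) = \mathsf{fall}$. $\vee$ and $\wedge$ are pointwise max and min. Two specifications $g_1,g_2$ separate above a set $S$ if there exists $S' \supseteq S$ with $g_1(S') \ne g_2(S')$. -}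

module Defs where

open import Data.Nat using (ℕ)
open import Data.Fin using (Fin; _≟_)
open import Data.Fin.Subset using (Subset; _⊆_; ⊤; inside; outside)
open import Data.Bool using (Bool; true; false; not; _∧_; if_then_else_)
open import Data.List using (List; []; _∷_; _++_; reverse; map; filter)
open import Data.Product using (_×_; _,_; ∃-syntax)
open import Data.Vec using (lookup)
open import Relation.Binary.PropositionalEquality using (_≡_; _≢_)
open import Relation.Nullary using (¬_; does)
open import Function.Bundles using (_⇔_)

-- Letters of the free group on Fin n: (variable, sign); true = x, false = -x.
Letter : ℕ → Set
Letter n = Fin n × Bool

-- Expressions = words in the letters; the free group element is the word
-- modulo free reduction (canceling adjacent x, -x).
Expr : ℕ → Set
Expr n = List (Letter n)

zeroE : ∀ {n} → Expr n
zeroE = []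

_⊕_ : ∀ {n} → Expr n → Expr n → Expr n
a ⊕ b = a ++ b

invLetter : ∀ {n} → Letter n → Letter n
invLetter (x , s) = (x , not s)

⊖_ : ∀ {n} → Expr n → Expr n
⊖ a = reverse (map invLetter a)

var : ∀ {n} → Fin n → Expr n
var x = (x , true) ∷ []

comm : ∀ {n} → Expr n → Expr n → Expr n
comm a b = a ⊕ (b ⊕ ((⊖ a) ⊕ (⊖ b)))

cancels : ∀ {n} → Letter n → Letter n → Bool
cancels (x , s) (y , t) = does (x ≟ y) ∧ (if s then not t else t)

push : ∀ {n} → Letter n → Expr n → Expr n
push l [] = l ∷ []
push l (m ∷ w) = if cancels l m then w else l ∷ m ∷ w

reduce : ∀ {n} → Expr n → Expr n
reduce [] = []
reduce (l ∷ w) = push l (reduce w)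

IsZero : ∀ {n} → Expr n → Set
IsZero h = reduce h ≡ []

-- h|_S : every variable in S set to 0 (letters of S deleted)
inS : ∀ {n} → Subset n → Letter n → Bool
inS S (x , _) with lookup S x
... | inside = true
... | outside = false

restrict : ∀ {n} → Subset n → Expr n → Expr n
restrict S [] = []
restrict S (l ∷ w) = if inS S l then restrict S w else l ∷ restrict S w

data Outcome : Set where
  hang fall : Outcome

data _≤O_ : Outcome → Outcome → Set where
  hang≤ : ∀ {o} → hang ≤O o
  fall≤fall : fall ≤O fall

_∨O_ : Outcome → Outcome → Outcome
hang ∨O o = o
fall ∨O _ = fall

_∧O_ : Outcome → Outcome → Outcome
hang ∧O _ = hang
fall ∧O o = o

record Spec (n : ℕ) : Set where
  field
    f : Subset n → Outcome
    monotone : ∀ {S S'} → S ⊆ S' → f S ≤O f S'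
    full : f ⊤ ≡ fall
open Spec public

_∧f_ : ∀ {n} → (Subset n → Outcome) → (Subset n → Outcome) → Subset n → Outcome
(g₁ ∧f g₂) S = g₁ S ∧O g₂ S

_∨f_ : ∀ {n} → (Subset n → Outcome) → (Subset n → Outcome) → Subset n → Outcome
(g₁ ∨f g₂) S = g₁ S ∨O g₂ S

Solves : ∀ {n} → Expr n → (Subset n → Outcome) → Set
Solves h f = ∀ S → IsZero (restrict S h) ⇔ (f S ≡ fall)

SeparateAbove : ∀ {n} → (Subset n → Outcome) → (Subset n → Outcome) → Subset n → Set
SeparateAbove g₁ g₂ S = ∃[ S' ] (S ⊆ S' × g₁ S' ≢ g₂ S')

-- Restriction h ↦ h|_S is an endomorphism of the free group, and h|_S′ = (h|_S)|_S′ for S ⊆ S′,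
-- so a restriction that vanishes at S vanishes above S.  Write a = h₁|_S and b = h₂|_S.
-- If a + b = 0 then above S the expression h₁ vanishes exactly where h₂ does, so g₁ and g₂
-- agree above S; separation then forbids both hanging at S, hence both fall.
-- If [a, b] = 0 while g₁ and g₂ both hang at S, then a and b are non-trivial and commute.
-- Commuting elements of a free group are powers of a common element, and free groups are
-- torsion-free, so every further restriction kills a exactly when it kills b: again g₁ and g₂
-- agree above S, contradicting separation.
-- The common root is never constructed: a is conjugated to a cyclically reduced word c, and the
-- claim is proved by induction on the length of b, using that words u, v with uv = vu literally
-- satisfy u^|v| = v^|u|.

module Submission where

open import Defs
open import Data.Nat using (ℕ)
open import Data.Product using (_×_)
open import Relation.Binary.PropositionalEquality using (_≡_)

open import Algebra.Bundles using (Group)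
open import Data.Bool using (Bool; true; false; not; if_then_else_)
open import Data.Bool.Properties using (∧-zeroʳ)
open import Data.Empty using (⊥; ⊥-elim)
open import Data.Fin using (Fin; _≟_)
open import Data.Fin.Subset using (Subset; _⊆_)
open import Data.Fin.Subset.Properties using (⊆-refl)
open import Data.List using (List; []; _∷_; _++_; _∷ʳ_; reverse; map; head; last; length; initLast; _∷ʳ′_)
open import Data.List.Properties
  using ( ++-assoc; ++-identityʳ; ∷-injectiveˡ; ∷-injectiveʳ; length-++; length-map; length-reverse
        ; map-++; map-∘; map-cong; map-id; unfold-reverse; reverse-++; reverse-map; reverse-involutive )
open import Data.List.Relation.Unary.Linked as Linked using (Linked; []; [-]; _∷_)
open import Data.List.Relation.Unary.Linked.Properties using (++⁺)
open import Data.Maybe using (Maybe; just; nothing)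
open import Data.Maybe.Relation.Binary.Connected using (Connected; drop-just; just; just-nothing; nothing)
open import Data.Nat using (zero; suc; _+_; _*_; _≤_; _<_; s≤s; ⌊_/2⌋)
open import Data.Nat.Induction using (<-wellFounded)
open import Data.Nat.Properties
  using (suc-injective; +-comm; *-comm; +-cancelˡ-≡; +-cancelʳ-≡; m≤m+n; m≤n+m; n≡⌊n+n/2⌋)
open import Data.Nat.Tactic.RingSolver using (solve-∀)
open import Data.Product using (_,_; proj₁)
open import Data.Sum using (_⊎_; inj₁; inj₂)
open import Data.Vec using (lookup)
open import Data.Vec.Properties using (lookup⇒[]=; []=⇒lookup)
open import Function.Bundles using (_⇔_; mk⇔; Equivalence)
open import Function.Properties.Equivalence using () renaming (sym to ⇔-sym; trans to ⇔-trans)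
open import Induction.WellFounded using (Acc; acc)
open import Level using (0ℓ)
open import Relation.Binary.Bundles using (Setoid)
open import Relation.Binary.PropositionalEquality
  using (_≢_; refl; sym; trans; cong; cong₂; subst; subst₂; module ≡-Reasoning)
import Relation.Binary.Reasoning.Setoid
open import Relation.Binary.Structures using (IsEquivalence)
open import Relation.Nullary using (¬_; yes; no; contradiction)

module GroupProperties {c ℓ} (G : Group c ℓ) where
  open Group G
  open import Algebra.Properties.Group G
  open import Relation.Binary.Reasoning.Setoid setoid

  x∙y≈ε⇒x≈ε⇔y≈ε : ∀ x y → x ∙ y ≈ ε → (x ≈ ε ⇔ y ≈ ε)
  x∙y≈ε⇒x≈ε⇔y≈ε x y x∙y≈ε = mk⇔
    (λ x≈ε → begin
      y        ≈⟨ identityˡ y ⟨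
      ε ∙ y    ≈⟨ ∙-congʳ x≈ε ⟨
      x ∙ y    ≈⟨ x∙y≈ε ⟩
      ε        ∎)
    (λ y≈ε → begin
      x        ≈⟨ identityʳ x ⟨
      x ∙ ε    ≈⟨ ∙-congˡ y≈ε ⟨
      x ∙ y    ≈⟨ x∙y≈ε ⟩
      ε        ∎)

  [_,_] : Carrier → Carrier → Carrier
  [ x , y ] = x ∙ (y ∙ (x ⁻¹ ∙ y ⁻¹))

  [x,y]≈ε⇒x∙y≈y∙x : ∀ x y → [ x , y ] ≈ ε → x ∙ y ≈ y ∙ x
  [x,y]≈ε⇒x∙y≈y∙x x y [x,y]≈ε = x∙y⁻¹≈ε⇒x≈y (x ∙ y) (y ∙ x) (begin
    x ∙ y ∙ (y ∙ x) ⁻¹         ≈⟨ ∙-congˡ (⁻¹-anti-homo-∙ y x) ⟩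
    x ∙ y ∙ (x ⁻¹ ∙ y ⁻¹)      ≈⟨ assoc x y _ ⟩
    [ x , y ]                  ≈⟨ [x,y]≈ε ⟩
    ε                          ∎)

  x≈ε⇒[x,y]≈ε : ∀ {x} y → x ≈ ε → [ x , y ] ≈ ε
  x≈ε⇒[x,y]≈ε {x} y x≈ε = begin
    x ∙ (y ∙ (x ⁻¹ ∙ y ⁻¹))    ≈⟨ ∙-cong x≈ε (∙-congˡ (∙-congʳ (⁻¹-cong x≈ε))) ⟩
    ε ∙ (y ∙ (ε ⁻¹ ∙ y ⁻¹))    ≈⟨ identityˡ _ ⟩
    y ∙ (ε ⁻¹ ∙ y ⁻¹)          ≈⟨ ∙-congˡ (∙-congʳ ε⁻¹≈ε) ⟩
    y ∙ (ε ∙ y ⁻¹)             ≈⟨ ∙-congˡ (identityˡ _) ⟩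
    y ∙ y ⁻¹                   ≈⟨ inverseʳ y ⟩
    ε                          ∎

  y≈ε⇒[x,y]≈ε : ∀ x {y} → y ≈ ε → [ x , y ] ≈ ε
  y≈ε⇒[x,y]≈ε x {y} y≈ε = begin
    x ∙ (y ∙ (x ⁻¹ ∙ y ⁻¹))    ≈⟨ ∙-congˡ (∙-cong y≈ε (∙-congˡ (⁻¹-cong y≈ε))) ⟩
    x ∙ (ε ∙ (x ⁻¹ ∙ ε ⁻¹))    ≈⟨ ∙-congˡ (identityˡ _) ⟩
    x ∙ (x ⁻¹ ∙ ε ⁻¹)          ≈⟨ \\-leftDividesˡ x (ε ⁻¹) ⟩
    ε ⁻¹                       ≈⟨ ε⁻¹≈ε ⟩
    ε                          ∎

  x⁻¹≈ε⇒x≈ε : ∀ {x} → x ⁻¹ ≈ ε → x ≈ ε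
  x⁻¹≈ε⇒x≈ε {x} x⁻¹≈ε = ⁻¹-injective (begin
    x ⁻¹    ≈⟨ x⁻¹≈ε ⟩
    ε       ≈⟨ ε⁻¹≈ε ⟨
    ε ⁻¹    ∎)

  conj : Carrier → Carrier → Carrier
  conj u x = u ⁻¹ ∙ (x ∙ u)

  conj-cong : ∀ u {x y} → x ≈ y → conj u x ≈ conj u y
  conj-cong u x≈y = ∙-congˡ (∙-congʳ x≈y)

  conj-ε : ∀ u → conj u ε ≈ ε
  conj-ε u = begin
    u ⁻¹ ∙ (ε ∙ u)   ≈⟨ ∙-congˡ (identityˡ u) ⟩
    u ⁻¹ ∙ u         ≈⟨ inverseˡ u ⟩
    ε                ∎

  conj-homo-∙ : ∀ u x y → conj u (x ∙ y) ≈ conj u x ∙ conj u y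
  conj-homo-∙ u x y = begin
    u ⁻¹ ∙ (x ∙ y ∙ u)                    ≈⟨ ∙-congˡ (assoc x y u) ⟩
    u ⁻¹ ∙ (x ∙ (y ∙ u))                  ≈⟨ ∙-congˡ (∙-congˡ (\\-leftDividesˡ u (y ∙ u))) ⟨
    u ⁻¹ ∙ (x ∙ (u ∙ (u ⁻¹ ∙ (y ∙ u))))   ≈⟨ ∙-congˡ (assoc x u _) ⟨
    u ⁻¹ ∙ (x ∙ u ∙ conj u y)             ≈⟨ assoc (u ⁻¹) (x ∙ u) _ ⟨
    conj u x ∙ conj u y                   ∎

  conj-≈ε⇒≈ε : ∀ u {x} → conj u x ≈ ε → x ≈ ε
  conj-≈ε⇒≈ε u {x} ux≈ε = begin
    x                      ≈⟨ //-rightDividesʳ u x ⟨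
    x ∙ u ∙ u ⁻¹           ≈⟨ ∙-congʳ (\\-leftDividesˡ u (x ∙ u)) ⟨
    u ∙ conj u x ∙ u ⁻¹    ≈⟨ ∙-congʳ (∙-congˡ ux≈ε) ⟩
    u ∙ ε ∙ u ⁻¹           ≈⟨ ∙-congʳ (identityʳ u) ⟩
    u ∙ u ⁻¹               ≈⟨ inverseʳ u ⟩
    ε                      ∎

  conj-inverse : ∀ u z → conj u (u ∙ (z ∙ u ⁻¹)) ≈ z
  conj-inverse u z = begin
    u ⁻¹ ∙ (u ∙ (z ∙ u ⁻¹) ∙ u)   ≈⟨ ∙-congˡ (assoc u _ u) ⟩
    u ⁻¹ ∙ (u ∙ (z ∙ u ⁻¹ ∙ u))   ≈⟨ \\-leftDividesʳ u _ ⟩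
    z ∙ u ⁻¹ ∙ u                  ≈⟨ //-rightDividesˡ u z ⟩
    z                             ∎

  conj-commute : ∀ u {x y} → x ∙ y ≈ y ∙ x → conj u x ∙ conj u y ≈ conj u y ∙ conj u x
  conj-commute u {x} {y} xy≈yx = begin
    conj u x ∙ conj u y    ≈⟨ conj-homo-∙ u x y ⟨
    conj u (x ∙ y)         ≈⟨ conj-cong u xy≈yx ⟩
    conj u (y ∙ x)         ≈⟨ conj-homo-∙ u y x ⟩
    conj u y ∙ conj u x    ∎

private variable
  A : Set
  R : A → A → Set
  k : ℕ

connected-nothing : (x : Maybe A) → Connected R x nothing
connected-nothing (just _) = just-nothing
connected-nothing nothing = nothing

last-∷ʳ : (xs : List A) (x : A) → last (xs ∷ʳ x) ≡ just x
last-∷ʳ [] x = refl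
last-∷ʳ (_ ∷ []) x = refl
last-∷ʳ (_ ∷ y ∷ xs) x = last-∷ʳ (y ∷ xs) x

linked-++⁻ˡ : (xs : List A) {ys : List A} → Linked R (xs ++ ys) → Linked R xs
linked-++⁻ˡ [] _ = []
linked-++⁻ˡ (_ ∷ []) _ = [-]
linked-++⁻ˡ (_ ∷ y ∷ xs) (r ∷ rs) = r ∷ linked-++⁻ˡ (y ∷ xs) rs

linked-++⁻ʳ : (xs : List A) {ys : List A} → Linked R (xs ++ ys) → Linked R ys
linked-++⁻ʳ [] rs = rs
linked-++⁻ʳ (_ ∷ xs) rs = linked-++⁻ʳ xs (Linked.tail rs)

++-injectiveˡ-length : (xs zs : List A) {ys ws : List A} → length xs ≡ length zs → xs ++ ys ≡ zs ++ ws → xs ≡ zs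
++-injectiveˡ-length [] [] _ _ = refl
++-injectiveˡ-length (x ∷ xs) (z ∷ zs) |xs|≡|zs| e =
  cong₂ _∷_ (∷-injectiveˡ e) (++-injectiveˡ-length xs zs (suc-injective |xs|≡|zs|) (∷-injectiveʳ e))

rotation⇒++-comm : {c p x : List A} → c ≡ p ++ x → c ≡ x ++ p → c ++ x ≡ x ++ c
rotation⇒++-comm {c = c} {p} {x} c≡px c≡xp = begin
  c ++ x           ≡⟨ cong (_++ x) c≡xp ⟩
  (x ++ p) ++ x    ≡⟨ ++-assoc x p x ⟩
  x ++ p ++ x      ≡⟨ cong (x ++_) c≡px ⟨
  x ++ c           ∎
  where open ≡-Reasoning

+-regroup : ∀ p q t → (p + q) + (t + t) ≡ (p + t) + (t + q)
+-regroup = solve-∀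

-- The lengths in x·y = p₁t₁·t₁⁻¹q₁ and y·x = p₂t₂·t₂⁻¹q₂ when both reduce to the same word.
equal-cancelled-length : ∀ {p₁ t₁ q₁ p₂ t₂ q₂ x y : ℕ} →
  x ≡ p₁ + t₁ → y ≡ t₁ + q₁ → y ≡ p₂ + t₂ → x ≡ t₂ + q₂ → p₁ + q₁ ≡ p₂ + q₂ → t₁ ≡ t₂
equal-cancelled-length {p₁} {t₁} {q₁} {p₂} {t₂} {q₂} {x} {y} x₁ y₁ y₂ x₂ same =
  trans (n≡⌊n+n/2⌋ t₁) (trans (cong ⌊_/2⌋ doubled) (sym (n≡⌊n+n/2⌋ t₂)))
  where
  doubled : t₁ + t₁ ≡ t₂ + t₂
  doubled = +-cancelˡ-≡ (p₁ + q₁) (t₁ + t₁) (t₂ + t₂) (begin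
    (p₁ + q₁) + (t₁ + t₁)   ≡⟨ +-regroup p₁ q₁ t₁ ⟩
    (p₁ + t₁) + (t₁ + q₁)   ≡⟨ cong₂ _+_ x₁ y₁ ⟨
    x + y                   ≡⟨ +-comm x y ⟩
    y + x                   ≡⟨ cong₂ _+_ y₂ x₂ ⟩
    (p₂ + t₂) + (t₂ + q₂)   ≡⟨ +-regroup p₂ q₂ t₂ ⟨
    (p₂ + q₂) + (t₂ + t₂)   ≡⟨ cong (_+ (t₂ + t₂)) same ⟨
    (p₁ + q₁) + (t₂ + t₂)   ∎)
    where open ≡-Reasoning

-- Free reduction

invLetter-involutive : (l : Letter k) → invLetter (invLetter l) ≡ l
invLetter-involutive (x , true) = refl
invLetter-involutive (x , false) = refl

cancels⇒≡invLetter : (l m : Letter k) → cancels l m ≡ true → m ≡ invLetter l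
cancels⇒≡invLetter (x , s) (y , t) e with x ≟ y
cancels⇒≡invLetter (x , true) (.x , false) e | yes refl = refl
cancels⇒≡invLetter (x , false) (.x , true) e | yes refl = refl
cancels⇒≡invLetter (x , true) (.x , true) () | yes refl
cancels⇒≡invLetter (x , false) (.x , false) () | yes refl
cancels⇒≡invLetter (x , s) (y , t) () | no _

cancels-invLetter : (l : Letter k) → cancels l (invLetter l) ≡ true
cancels-invLetter (x , s) with x ≟ x
cancels-invLetter (x , true) | yes _ = refl
cancels-invLetter (x , false) | yes _ = refl
... | no x≢x = contradiction refl x≢x

cancels-irrefl : (l : Letter k) → cancels l l ≡ false
cancels-irrefl (x , true) = ∧-zeroʳ _
cancels-irrefl (x , false) = ∧-zeroʳ _

NoCancel : Letter k → Letter k → Set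
NoCancel l m = cancels l m ≡ false

¬noCancel-invLetter : (l : Letter k) → ¬ NoCancel l (invLetter l)
¬noCancel-invLetter l l≁l⁻¹ with trans (sym l≁l⁻¹) (cancels-invLetter l)
... | ()

Reduced : Expr k → Set
Reduced = Linked NoCancel

CyclicallyReduced : Expr k → Set
CyclicallyReduced w = Reduced w × Connected NoCancel (last w) (head w)

push-noCancel : {l : Letter k} {w : Expr k} → Connected NoCancel (just l) (head w) → push l w ≡ l ∷ w
push-noCancel {w = []} _ = refl
push-noCancel {w = _ ∷ _} (just l≁m) rewrite l≁m = refl

push-cancels : {l m : Letter k} (w : Expr k) → cancels l m ≡ true → push l (m ∷ w) ≡ w
push-cancels _ l∼m rewrite l∼m = refl

push-reduced : (l : Letter k) {w : Expr k} → Reduced w → Reduced (push l w)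
push-reduced l {[]} _ = [-]
push-reduced l {m ∷ w} rw with cancels l m in l∼m
... | true = Linked.tail rw
... | false = l∼m ∷ rw

reduce-reduced : (w : Expr k) → Reduced (reduce w)
reduce-reduced [] = []
reduce-reduced (l ∷ w) = push-reduced l (reduce-reduced w)

reduced⇒reduce≡ : {w : Expr k} → Reduced w → reduce w ≡ w
reduced⇒reduce≡ [] = refl
reduced⇒reduce≡ [-] = refl
reduced⇒reduce≡ (l≁m ∷ rw) rewrite reduced⇒reduce≡ rw = push-noCancel (just l≁m)

push-push-cancel : {l m : Letter k} {w : Expr k} → cancels l m ≡ true → Reduced w → push l (push m w) ≡ w
push-push-cancel {w = []} l∼m _ rewrite l∼m = refl
push-push-cancel {l = l} {m} {j ∷ w} l∼m rw with cancels m j in m∼j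
... | false rewrite l∼m = refl
... | true rewrite cancels⇒≡invLetter m j m∼j | cancels⇒≡invLetter l m l∼m | invLetter-involutive l =
  push-noCancel (Linked.head′ rw)

cyclicallyReduced-wrap : {c : Expr k} → CyclicallyReduced c →
  {h j : Letter k} {w : Expr k} → c ≡ h ∷ w ∷ʳ j → NoCancel j h
cyclicallyReduced-wrap (_ , wraps) {h} {j} {w} refl =
  drop-just (subst (λ x → Connected NoCancel x (just h)) (last-∷ʳ (h ∷ w) j) wraps)

-- The free group

infix 4 _≈_
record _≈_ (a b : Expr k) : Set where
  constructor mk≈
  field reduce-≡ : reduce a ≡ reduce b
open _≈_ public

≈-isEquivalence : IsEquivalence (_≈_ {k})
≈-isEquivalence = record
  { refl = mk≈ refl
  ; sym = λ (mk≈ e) → mk≈ (sym e)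
  ; trans = λ (mk≈ e) (mk≈ e′) → mk≈ (trans e e′)
  }

module ≈ {k} = IsEquivalence (≈-isEquivalence {k})

≈-setoid : ℕ → Setoid 0ℓ 0ℓ
≈-setoid k = record { isEquivalence = ≈-isEquivalence {k} }

module ≈-Reasoning {k} = Relation.Binary.Reasoning.Setoid (≈-setoid k)

≡⇒≈ : {a b : Expr k} → a ≡ b → a ≈ b
≡⇒≈ refl = mk≈ refl

reduce-≈ : (a : Expr k) → reduce a ≈ a
reduce-≈ a = mk≈ (reduced⇒reduce≡ (reduce-reduced a))

∷-cong : (l : Letter k) {a b : Expr k} → a ≈ b → l ∷ a ≈ l ∷ b
∷-cong l (mk≈ e) = mk≈ (cong (push l) e)

cancel-pair : (l : Letter k) (w : Expr k) → l ∷ invLetter l ∷ w ≈ w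
cancel-pair l w = mk≈ (push-push-cancel (cancels-invLetter l) (reduce-reduced w))

++-congˡ : (a : Expr k) {b b′ : Expr k} → b ≈ b′ → a ++ b ≈ a ++ b′
++-congˡ [] b≈b′ = b≈b′
++-congˡ (l ∷ a) b≈b′ = ∷-cong l (++-congˡ a b≈b′)

∷-≈-push : (l : Letter k) (w b : Expr k) → (l ∷ w) ++ b ≈ push l w ++ b
∷-≈-push l [] b = mk≈ refl
∷-≈-push l (m ∷ w) b with cancels l m in l∼m
... | false = mk≈ refl
... | true rewrite cancels⇒≡invLetter l m l∼m = cancel-pair l (w ++ b)

++-reduceˡ : (a b : Expr k) → a ++ b ≈ reduce a ++ b
++-reduceˡ [] b = mk≈ refl
++-reduceˡ (l ∷ a) b = begin
  l ∷ (a ++ b)              ≈⟨ ∷-cong l (++-reduceˡ a b) ⟩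
  (l ∷ reduce a) ++ b       ≈⟨ ∷-≈-push l (reduce a) b ⟩
  push l (reduce a) ++ b    ∎
  where open ≈-Reasoning

++-congʳ : {a a′ : Expr k} (b : Expr k) → a ≈ a′ → a ++ b ≈ a′ ++ b
++-congʳ {a = a} {a′} b (mk≈ e) = begin
  a ++ b           ≈⟨ ++-reduceˡ a b ⟩
  reduce a ++ b    ≡⟨ cong (_++ b) e ⟩
  reduce a′ ++ b   ≈⟨ ++-reduceˡ a′ b ⟨
  a′ ++ b          ∎
  where open ≈-Reasoning

++-cong : {a a′ b b′ : Expr k} → a ≈ a′ → b ≈ b′ → a ++ b ≈ a′ ++ b′
++-cong {a′ = a′} {b} a≈a′ b≈b′ = ≈.trans (++-congʳ b a≈a′) (++-congˡ a′ b≈b′)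

⊖-∷ : (l : Letter k) (w : Expr k) → ⊖ (l ∷ w) ≡ ⊖ w ++ invLetter l ∷ []
⊖-∷ l w = unfold-reverse (invLetter l) (map invLetter w)

⊖-++ : (a b : Expr k) → ⊖ (a ++ b) ≡ ⊖ b ++ ⊖ a
⊖-++ a b = trans (cong reverse (map-++ invLetter a b)) (reverse-++ (map invLetter a) (map invLetter b))

⊖-involutive : (a : Expr k) → ⊖ (⊖ a) ≡ a
⊖-involutive a = begin
  reverse (map invLetter (reverse (map invLetter a)))   ≡⟨ cong reverse (reverse-map invLetter (map invLetter a)) ⟩
  reverse (reverse (map invLetter (map invLetter a)))   ≡⟨ reverse-involutive _ ⟩
  map invLetter (map invLetter a)                       ≡⟨ map-∘ a ⟨
  map (λ l → invLetter (invLetter l)) a                 ≡⟨ map-cong invLetter-involutive a ⟩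
  map (λ l → l) a                                       ≡⟨ map-id a ⟩
  a                                                     ∎
  where open ≡-Reasoning

length-⊖ : (w : Expr k) → length (⊖ w) ≡ length w
length-⊖ w = trans (length-reverse (map invLetter w)) (length-map invLetter w)

⊖-inverseʳ : (a : Expr k) → a ++ ⊖ a ≈ []
⊖-inverseʳ [] = mk≈ refl
⊖-inverseʳ (l ∷ a) = begin
  l ∷ (a ++ ⊖ (l ∷ a))                     ≡⟨ cong (λ w → l ∷ (a ++ w)) (⊖-∷ l a) ⟩
  l ∷ (a ++ (⊖ a ++ invLetter l ∷ []))     ≡⟨ cong (l ∷_) (++-assoc a (⊖ a) _) ⟨
  l ∷ ((a ++ ⊖ a) ++ invLetter l ∷ [])     ≈⟨ ∷-cong l (++-congʳ _ (⊖-inverseʳ a)) ⟩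
  l ∷ invLetter l ∷ []                     ≈⟨ cancel-pair l [] ⟩
  []                                       ∎
  where open ≈-Reasoning

⊖-inverseˡ : (a : Expr k) → ⊖ a ++ a ≈ []
⊖-inverseˡ a = subst (λ w → ⊖ a ++ w ≈ []) (⊖-involutive a) (⊖-inverseʳ (⊖ a))

⊖-cong : {a b : Expr k} → a ≈ b → ⊖ a ≈ ⊖ b
⊖-cong {a = a} {b} a≈b = begin
  ⊖ a                   ≡⟨ ++-identityʳ (⊖ a) ⟨
  ⊖ a ++ []             ≈⟨ ++-congˡ (⊖ a) (⊖-inverseʳ b) ⟨
  ⊖ a ++ (b ++ ⊖ b)     ≈⟨ ++-congˡ (⊖ a) (++-congʳ (⊖ b) a≈b) ⟨
  ⊖ a ++ (a ++ ⊖ b)     ≡⟨ ++-assoc (⊖ a) a (⊖ b) ⟨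
  (⊖ a ++ a) ++ ⊖ b     ≈⟨ ++-congʳ (⊖ b) (⊖-inverseˡ a) ⟩
  ⊖ b                   ∎
  where open ≈-Reasoning

freeGroup : ℕ → Group 0ℓ 0ℓ
freeGroup k = record
  { Carrier = Expr k
  ; _≈_ = _≈_
  ; _∙_ = _++_
  ; ε = []
  ; _⁻¹ = ⊖_
  ; isGroup = record
    { isMonoid = record
      { isSemigroup = record
        { isMagma = record { isEquivalence = ≈-isEquivalence ; ∙-cong = ++-cong }
        ; assoc = λ a b c → ≡⇒≈ (++-assoc a b c)
        }
      ; identity = (λ a → mk≈ refl) , (λ a → ≡⇒≈ (++-identityʳ a))
      }
    ; inverse = ⊖-inverseˡ , ⊖-inverseʳ
    ; ⁻¹-cong = ⊖-cong
    }
  }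

module FreeGroupProperties {k : ℕ} = GroupProperties (freeGroup k)
open FreeGroupProperties

-- Restriction

inS≡lookup : (S : Subset k) (x : Fin k) (s : Bool) → inS S (x , s) ≡ lookup S x
inS≡lookup S x s with lookup S x
... | true = refl
... | false = refl

inS-mono : {S S′ : Subset k} → S ⊆ S′ → (l : Letter k) → inS S l ≡ true → inS S′ l ≡ true
inS-mono {S = S} {S′} S⊆S′ (x , s) l∈S =
  trans (inS≡lookup S′ x s) ([]=⇒lookup (S⊆S′ (lookup⇒[]= x S (trans (sym (inS≡lookup S x s)) l∈S))))

restrict-++ : (S : Subset k) (a b : Expr k) → restrict S (a ++ b) ≡ restrict S a ++ restrict S b
restrict-++ S [] b = refl
restrict-++ S (l ∷ a) b with inS S l
... | true = restrict-++ S a b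
... | false = cong (l ∷_) (restrict-++ S a b)

restrict-⊖-singleton : (S : Subset k) (l : Letter k) → restrict S (⊖ (l ∷ [])) ≡ ⊖ (restrict S (l ∷ []))
restrict-⊖-singleton S (x , s) rewrite inS≡lookup S x (not s) | inS≡lookup S x s with lookup S x
... | true = refl
... | false = refl

restrict-⊖ : (S : Subset k) (a : Expr k) → restrict S (⊖ a) ≡ ⊖ (restrict S a)
restrict-⊖ S [] = refl
restrict-⊖ {k} S (l ∷ a) = begin
  φ (⊖ ((l ∷ []) ++ a))          ≡⟨ cong φ (⊖-++ (l ∷ []) a) ⟩
  φ (⊖ a ++ ⊖ (l ∷ []))          ≡⟨ restrict-++ S (⊖ a) _ ⟩
  φ (⊖ a) ++ φ (⊖ (l ∷ []))      ≡⟨ cong₂ _++_ (restrict-⊖ S a) (restrict-⊖-singleton S l) ⟩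
  ⊖ φ a ++ ⊖ φ (l ∷ [])          ≡⟨ ⊖-++ (φ (l ∷ [])) (φ a) ⟨
  ⊖ (φ (l ∷ []) ++ φ a)          ≡⟨ cong ⊖_ (restrict-++ S (l ∷ []) a) ⟨
  ⊖ φ (l ∷ a)                    ∎
  where
  φ : Expr k → Expr k
  φ = restrict S
  open ≡-Reasoning

restrict-comm : (S : Subset k) (a b : Expr k) → restrict S (comm a b) ≡ [ restrict S a , restrict S b ]
restrict-comm {k} S a b = begin
  φ (a ++ b ++ ⊖ a ++ ⊖ b)            ≡⟨ restrict-++ S a _ ⟩
  φ a ++ φ (b ++ ⊖ a ++ ⊖ b)          ≡⟨ cong (φ a ++_) (restrict-++ S b _) ⟩
  φ a ++ φ b ++ φ (⊖ a ++ ⊖ b)        ≡⟨ cong (λ w → φ a ++ φ b ++ w) (restrict-++ S (⊖ a) (⊖ b)) ⟩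
  φ a ++ φ b ++ φ (⊖ a) ++ φ (⊖ b)    ≡⟨ cong₂ (λ x y → φ a ++ φ b ++ x ++ y) (restrict-⊖ S a) (restrict-⊖ S b) ⟩
  [ φ a , φ b ]                        ∎
  where
  φ : Expr k → Expr k
  φ = restrict S
  open ≡-Reasoning

restrict-conj : (S : Subset k) (u x : Expr k) → restrict S (conj u x) ≡ conj (restrict S u) (restrict S x)
restrict-conj S u x = begin
  restrict S (⊖ u ++ x ++ u)                         ≡⟨ restrict-++ S (⊖ u) (x ++ u) ⟩
  restrict S (⊖ u) ++ restrict S (x ++ u)            ≡⟨ cong₂ _++_ (restrict-⊖ S u) (restrict-++ S x u) ⟩
  ⊖ restrict S u ++ restrict S x ++ restrict S u     ∎
  where open ≡-Reasoning

restrict-∷-cong : (S : Subset k) (l : Letter k) {a b : Expr k} →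
  restrict S a ≈ restrict S b → restrict S (l ∷ a) ≈ restrict S (l ∷ b)
restrict-∷-cong S l φa≈φb with inS S l
... | true = φa≈φb
... | false = ∷-cong l φa≈φb

restrict-cancel-pair : (S : Subset k) (l : Letter k) (w : Expr k) → restrict S (l ∷ invLetter l ∷ w) ≈ restrict S w
restrict-cancel-pair S (x , s) w rewrite inS≡lookup S x (not s) | inS≡lookup S x s with lookup S x
... | true = mk≈ refl
... | false = cancel-pair (x , s) (restrict S w)

restrict-push : (S : Subset k) (l : Letter k) (w : Expr k) → restrict S (l ∷ w) ≈ restrict S (push l w)
restrict-push S l [] = mk≈ refl
restrict-push S l (m ∷ w) with cancels l m in l∼m
... | false = mk≈ refl
... | true rewrite cancels⇒≡invLetter l m l∼m = restrict-cancel-pair S l w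

restrict-reduce : (S : Subset k) (a : Expr k) → restrict S a ≈ restrict S (reduce a)
restrict-reduce S [] = mk≈ refl
restrict-reduce S (l ∷ a) = begin
  restrict S (l ∷ a)                ≈⟨ restrict-∷-cong S l {a} {reduce a} (restrict-reduce S a) ⟩
  restrict S (l ∷ reduce a)         ≈⟨ restrict-push S l (reduce a) ⟩
  restrict S (push l (reduce a))    ∎
  where open ≈-Reasoning

restrict-cong : (S : Subset k) {a b : Expr k} → a ≈ b → restrict S a ≈ restrict S b
restrict-cong S {a} {b} (mk≈ e) = begin
  restrict S a             ≈⟨ restrict-reduce S a ⟩
  restrict S (reduce a)    ≡⟨ cong (restrict S) e ⟩
  restrict S (reduce b)    ≈⟨ restrict-reduce S b ⟨
  restrict S b             ∎
  where open ≈-Reasoning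

restrict-⊆ : {S S′ : Subset k} → S ⊆ S′ → (a : Expr k) → restrict S′ (restrict S a) ≡ restrict S′ a
restrict-⊆ S⊆S′ [] = refl
restrict-⊆ {S = S} {S′} S⊆S′ (l ∷ a) with inS S l in l∈S
... | true rewrite inS-mono S⊆S′ l l∈S = restrict-⊆ S⊆S′ a
... | false = cong (λ w → if inS S′ l then w else l ∷ w) (restrict-⊆ S⊆S′ a)

restrict-≈[]-⊆ : {S S′ : Subset k} → S ⊆ S′ → (h : Expr k) → restrict S h ≈ [] → restrict S′ h ≈ []
restrict-≈[]-⊆ {S = S} {S′} S⊆S′ h φh≈[] = begin
  restrict S′ h                 ≡⟨ restrict-⊆ S⊆S′ h ⟨
  restrict S′ (restrict S h)    ≈⟨ restrict-cong S′ φh≈[] ⟩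
  []                            ∎
  where open ≈-Reasoning

restrict-⊖-≈[] : (S : Subset k) (b : Expr k) → restrict S (⊖ b) ≈ [] → restrict S b ≈ []
restrict-⊖-≈[] S b φb⁻¹≈[] = x⁻¹≈ε⇒x≈ε (subst (_≈ []) (restrict-⊖ S b) φb⁻¹≈[])

-- Powers, cyclic reduction and torsion-freeness

infixr 8 _^_
_^_ : Expr k → ℕ → Expr k
w ^ zero = []
w ^ suc m = w ++ w ^ m

restrict-^ : (S : Subset k) (w : Expr k) (m : ℕ) → restrict S (w ^ m) ≡ restrict S w ^ m
restrict-^ S w zero = refl
restrict-^ S w (suc m) = trans (restrict-++ S w (w ^ m)) (cong (restrict S w ++_) (restrict-^ S w m))

length-^ : (w : Expr k) (m : ℕ) → length (w ^ m) ≡ m * length w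
length-^ w zero = refl
length-^ w (suc m) = trans (length-++ w) (cong (length w +_) (length-^ w m))

^-cong : {a b : Expr k} → a ≈ b → (m : ℕ) → a ^ m ≈ b ^ m
^-cong a≈b zero = mk≈ refl
^-cong a≈b (suc m) = ++-cong a≈b (^-cong a≈b m)

^-≈[] : {w : Expr k} → w ≈ [] → (m : ℕ) → w ^ m ≈ []
^-≈[] w≈[] zero = mk≈ refl
^-≈[] {w = w} w≈[] (suc m) = ++-cong w≈[] (^-≈[] w≈[] m)

conj-^ : (u w : Expr k) (m : ℕ) → conj u (w ^ m) ≈ conj u w ^ m
conj-^ u w zero = conj-ε u
conj-^ u w (suc m) = begin
  conj u (w ++ w ^ m)              ≈⟨ conj-homo-∙ u w (w ^ m) ⟩
  conj u w ++ conj u (w ^ m)       ≈⟨ ++-congˡ (conj u w) (conj-^ u w m) ⟩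
  conj u w ++ conj u w ^ m         ∎
  where open ≈-Reasoning

^-reduced : {z : Expr k} → CyclicallyReduced z → (m : ℕ) → Reduced (z ^ m)
^-reduced _ zero = []
^-reduced {z = []} cz (suc m) = ^-reduced cz m
^-reduced {z = l ∷ z} (rz , wraps) (suc m) = ++⁺ rz (junction m) (^-reduced (rz , wraps) m)
  where
  junction : (m : ℕ) → Connected NoCancel (last (l ∷ z)) (head ((l ∷ z) ^ m))
  junction zero = connected-nothing (last (l ∷ z))
  junction (suc _) = wraps

^-≉[] : {z : Expr k} → CyclicallyReduced z → z ≢ [] → (m : ℕ) → ¬ z ^ suc m ≈ []
^-≉[] {z = []} _ z≢[] _ _ = z≢[] refl
^-≉[] {z = _ ∷ _} cz _ m (mk≈ e) with trans (sym (reduced⇒reduce≡ (^-reduced cz (suc m)))) e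
... | ()

record CyclicConjugate (w : Expr k) : Set where
  field
    conjugator core : Expr k
    w≡ : w ≡ conjugator ++ core ++ ⊖ conjugator
    core-cyclic : CyclicallyReduced core
    core≢[] : core ≢ []

self-cyclicConjugate : {l j : Letter k} {i : Expr k} →
  Reduced (l ∷ i ∷ʳ j) → NoCancel j l → CyclicConjugate (l ∷ i ∷ʳ j)
self-cyclicConjugate {l = l} {j} {i} rw j≁l = record
  { conjugator = []
  ; core = l ∷ i ∷ʳ j
  ; w≡ = sym (++-identityʳ _)
  ; core-cyclic = rw , subst (λ x → Connected NoCancel x (just l)) (sym (last-∷ʳ (l ∷ i) j)) (just j≁l)
  ; core≢[] = λ ()
  }

cyclicConjugate-acc : {w : Expr k} → Acc _<_ (length w) → Reduced w → w ≢ [] → CyclicConjugate w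
cyclicConjugate-acc {w = []} _ _ w≢[] = contradiction refl w≢[]
cyclicConjugate-acc {w = l ∷ w} (acc rec) rw _ with initLast w
... | [] = record
  { conjugator = []
  ; core = l ∷ []
  ; w≡ = refl
  ; core-cyclic = [-] , just (cancels-irrefl l)
  ; core≢[] = λ ()
  }
... | i ∷ʳ′ j with cancels j l in j∼l
...   | false = self-cyclicConjugate rw j∼l
...   | true = record
  { conjugator = l ∷ u
  ; core = core
  ; w≡ = cong (l ∷_) (begin
      i ++ j ∷ []                          ≡⟨ cong₂ (λ x y → x ++ y ∷ []) w≡ j≡l⁻¹ ⟩
      (u ++ core ++ ⊖ u) ++ invLetter l ∷ []  ≡⟨ ++-assoc u _ _ ⟩
      u ++ (core ++ ⊖ u) ++ invLetter l ∷ []  ≡⟨ cong (u ++_) (++-assoc core _ _) ⟩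
      u ++ core ++ ⊖ u ++ invLetter l ∷ []    ≡⟨ cong (λ x → u ++ core ++ x) (⊖-∷ l u) ⟨
      u ++ core ++ ⊖ (l ∷ u)                  ∎)
  ; core-cyclic = core-cyclic
  ; core≢[] = core≢[]
  }
  where
  j≡l⁻¹ : j ≡ invLetter l
  j≡l⁻¹ = trans (sym (invLetter-involutive j)) (cong invLetter (sym (cancels⇒≡invLetter j l j∼l)))
  i≢[] : i ≢ []
  i≢[] i≡[] = ¬noCancel-invLetter l
    (subst (NoCancel l) j≡l⁻¹ (Linked.head (subst (λ x → Reduced (l ∷ x ∷ʳ j)) i≡[] rw)))
  |i|<|w| : length i < length (l ∷ i ∷ʳ j)
  |i|<|w| = s≤s (subst (length i ≤_) (sym (length-++ i)) (m≤m+n (length i) 1))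
  open CyclicConjugate (cyclicConjugate-acc (rec |i|<|w|) (linked-++⁻ˡ i (Linked.tail rw)) i≢[])
    renaming (conjugator to u)
  open ≡-Reasoning

cyclicConjugate : {w : Expr k} → Reduced w → w ≢ [] → CyclicConjugate w
cyclicConjugate rw = cyclicConjugate-acc (<-wellFounded _) rw

≈[]⊎cyclicConjugate : (w : Expr k) → w ≈ [] ⊎ CyclicConjugate (reduce w)
≈[]⊎cyclicConjugate w with reduce w in e | reduce-reduced w
... | [] | _ = inj₁ (mk≈ e)
... | _ ∷ _ | rw = inj₂ (cyclicConjugate rw λ ())

core≈conj : (w : Expr k) (C : CyclicConjugate (reduce w)) →
  CyclicConjugate.core C ≈ conj (CyclicConjugate.conjugator C) w
core≈conj w C = begin
  core                       ≈⟨ conj-inverse u core ⟨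
  conj u (u ++ core ++ ⊖ u)  ≡⟨ cong (conj u) w≡ ⟨
  conj u (reduce w)          ≈⟨ conj-cong u {reduce w} (reduce-≈ w) ⟩
  conj u w                   ∎
  where
  open CyclicConjugate C renaming (conjugator to u)
  open ≈-Reasoning

^-torsionFree : (m : ℕ) (w : Expr k) → w ^ suc m ≈ [] → w ≈ []
^-torsionFree m w wᵐ≈[] with ≈[]⊎cyclicConjugate w
... | inj₁ w≈[] = w≈[]
... | inj₂ C = contradiction (begin
  core ^ suc m          ≈⟨ ^-cong (core≈conj w C) (suc m) ⟩
  conj u w ^ suc m      ≈⟨ conj-^ u w (suc m) ⟨
  conj u (w ^ suc m)    ≈⟨ conj-cong u {w ^ suc m} wᵐ≈[] ⟩
  conj u []             ≈⟨ conj-ε u ⟩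
  []                    ∎) (^-≉[] core-cyclic core≢[] m)
  where
  open CyclicConjugate C renaming (conjugator to u)
  open ≈-Reasoning

-- Commuting elements

^-++-comm : {u v : Expr k} → u ++ v ≡ v ++ u → (m : ℕ) → u ^ m ++ v ≡ v ++ u ^ m
^-++-comm {v = v} _ zero = sym (++-identityʳ v)
^-++-comm {u = u} {v} uv≡vu (suc m) = begin
  (u ++ u ^ m) ++ v     ≡⟨ ++-assoc u (u ^ m) v ⟩
  u ++ u ^ m ++ v       ≡⟨ cong (u ++_) (^-++-comm uv≡vu m) ⟩
  u ++ v ++ u ^ m       ≡⟨ ++-assoc u v (u ^ m) ⟨
  (u ++ v) ++ u ^ m     ≡⟨ cong (_++ u ^ m) uv≡vu ⟩
  (v ++ u) ++ u ^ m     ≡⟨ ++-assoc v u (u ^ m) ⟩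
  v ++ u ++ u ^ m       ∎
  where open ≡-Reasoning

++-comm⇒^-length : {u v : Expr k} → u ++ v ≡ v ++ u → u ^ length v ≡ v ^ length u
++-comm⇒^-length {u = u} {v} uv≡vu = ++-injectiveˡ-length (u ^ length v) (v ^ length u) equal-length
  (sym (^-++-comm (sym (^-++-comm uv≡vu (length v))) (length u)))
  where
  equal-length : length (u ^ length v) ≡ length (v ^ length u)
  equal-length = trans (length-^ u (length v)) (trans (*-comm (length v) (length u)) (sym (length-^ v (length u))))

restrict-commuting-word : (S : Subset k) {c v : Expr k} → c ≢ [] → c ++ v ≡ v ++ c →
  restrict S c ≈ [] → restrict S v ≈ []
restrict-commuting-word S {[]} c≢[] _ _ = contradiction refl c≢[]
restrict-commuting-word S {c@(_ ∷ c′)} {v} _ cv≡vc φc≈[] = ^-torsionFree (length c′) (restrict S v) (begin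
  restrict S v ^ length c      ≡⟨ restrict-^ S v (length c) ⟨
  restrict S (v ^ length c)    ≡⟨ cong (restrict S) (++-comm⇒^-length {u = c} cv≡vc) ⟨
  restrict S (c ^ length v)    ≡⟨ restrict-^ S c (length v) ⟩
  restrict S c ^ length v      ≈⟨ ^-≈[] φc≈[] (length v) ⟩
  []                           ∎)
  where open ≈-Reasoning

record Cancellation (x y : Expr k) : Set where
  constructor mkCancellation
  field
    prefix cancelled suffix : Expr k
    x≡ : x ≡ prefix ++ cancelled
    y≡ : y ≡ ⊖ cancelled ++ suffix
    reduce≡ : reduce (x ++ y) ≡ prefix ++ suffix

  length-x : length x ≡ length prefix + length cancelled
  length-x = trans (cong length x≡) (length-++ prefix)

  length-y : length y ≡ length cancelled + length suffix
  length-y = trans (cong length y≡) (trans (length-++ (⊖ cancelled)) (cong (_+ length suffix) (length-⊖ cancelled)))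

cancellation-keep : {l : Letter k} {x y : Expr k} (C : Cancellation x y) →
  let open Cancellation C in Connected NoCancel (just l) (head (prefix ++ suffix)) → Cancellation (l ∷ x) y
cancellation-keep {l = l} (mkCancellation p t q x≡ y≡ r≡) l≁ =
  mkCancellation (l ∷ p) t q (cong (l ∷_) x≡) y≡ (trans (cong (push l) r≡) (push-noCancel l≁))

cancellation : {x y : Expr k} → Reduced x → Reduced y → Cancellation x y
cancellation {x = []} {y} _ ry = mkCancellation [] [] y refl refl (reduced⇒reduce≡ ry)
cancellation {x = l ∷ x} {y} rx ry with cancellation (Linked.tail rx) ry
... | C@(mkCancellation (_ ∷ _) _ _ refl _ _) = cancellation-keep C (Linked.head′ rx)
... | C@(mkCancellation [] _ [] _ _ _) = cancellation-keep C just-nothing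
... | C@(mkCancellation [] t (m ∷ q) x≡ y≡ r≡) with cancels l m in l∼m
...   | false = cancellation-keep C (just l∼m)
...   | true = mkCancellation [] (l ∷ t) q (cong (l ∷_) x≡) y≡′ (trans (cong (push l) r≡) (push-cancels q l∼m))
  where
  y≡′ : y ≡ ⊖ (l ∷ t) ++ q
  y≡′ = begin
    y                             ≡⟨ y≡ ⟩
    ⊖ t ++ m ∷ q                  ≡⟨ cong (λ j → ⊖ t ++ j ∷ q) (cancels⇒≡invLetter l m l∼m) ⟩
    ⊖ t ++ invLetter l ∷ q        ≡⟨ ++-assoc (⊖ t) (invLetter l ∷ []) q ⟨
    (⊖ t ++ invLetter l ∷ []) ++ q ≡⟨ cong (_++ q) (⊖-∷ l t) ⟨
    ⊖ (l ∷ t) ++ q                ∎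
    where open ≡-Reasoning

module _ {x y : Expr k} (C₁ : Cancellation x y) (C₂ : Cancellation y x) (xy≈yx : x ++ y ≈ y ++ x) where
  private
    module C₁ = Cancellation C₁
    module C₂ = Cancellation C₂

  swap-reducts : C₁.prefix ++ C₁.suffix ≡ C₂.prefix ++ C₂.suffix
  swap-reducts = trans (sym C₁.reduce≡) (trans (reduce-≡ xy≈yx) C₂.reduce≡)

  swap-cancelled-length : length C₁.cancelled ≡ length C₂.cancelled
  swap-cancelled-length = equal-cancelled-length C₁.length-x C₁.length-y C₂.length-x C₂.length-y
    (trans (sym (length-++ C₁.prefix)) (trans (cong length swap-reducts) (length-++ C₂.prefix)))

  swap-prefix-length : length C₂.prefix ≡ length C₁.suffix
  swap-prefix-length = +-cancelʳ-≡ (length C₂.cancelled) (length C₂.prefix) (length C₁.suffix) (begin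
    length C₂.prefix + length C₂.cancelled    ≡⟨ C₂.length-x ⟨
    length y                                  ≡⟨ C₁.length-y ⟩
    length C₁.cancelled + length C₁.suffix    ≡⟨ cong (_+ length C₁.suffix) swap-cancelled-length ⟩
    length C₂.cancelled + length C₁.suffix    ≡⟨ +-comm (length C₂.cancelled) _ ⟩
    length C₁.suffix + length C₂.cancelled    ∎)
    where open ≡-Reasoning

no-suffix⇒⊖-commute : {c b : Expr k} (C₁ : Cancellation c b) (C₂ : Cancellation b c) → c ++ b ≈ b ++ c →
  Cancellation.suffix C₁ ≡ [] → c ++ ⊖ b ≡ ⊖ b ++ c
no-suffix⇒⊖-commute C₁@(mkCancellation _ _ _ _ _ _) C₂@(mkCancellation (_ ∷ _) _ _ _ _ _) cb≈bc refl
  with () ← swap-prefix-length C₁ C₂ cb≈bc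
no-suffix⇒⊖-commute {b = b}
  C₁@(mkCancellation p₁ t₁ _ c≡₁ b≡₁ _) C₂@(mkCancellation [] t₂ q₂ b≡₂ c≡₂ _) cb≈bc refl =
  rotation⇒++-comm (trans c≡₁ (cong (p₁ ++_) (sym ⊖b≡t₁))) (trans c≡₂ (cong₂ _++_ (cong ⊖_ (sym b≡₂)) q₂≡p₁))
  where
  ⊖b≡t₁ : ⊖ b ≡ t₁
  ⊖b≡t₁ = trans (cong ⊖_ (trans b≡₁ (++-identityʳ (⊖ t₁)))) (⊖-involutive t₁)
  q₂≡p₁ : q₂ ≡ p₁
  q₂≡p₁ = trans (sym (swap-reducts C₁ C₂ cb≈bc)) (++-identityʳ p₁)

no-cancellation⇒commute : {c b : Expr k} (C₁ : Cancellation c b) (C₂ : Cancellation b c) → c ++ b ≈ b ++ c →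
  Cancellation.cancelled C₁ ≡ [] → c ++ b ≡ b ++ c
no-cancellation⇒commute C₁@(mkCancellation _ _ _ _ _ _) C₂@(mkCancellation _ (_ ∷ _) _ _ _ _) cb≈bc refl
  with () ← swap-cancelled-length C₁ C₂ cb≈bc
no-cancellation⇒commute {c = c} {b}
  C₁@(mkCancellation p₁ _ q₁ c≡₁ b≡₁ _) C₂@(mkCancellation p₂ [] q₂ b≡₂ c≡₂ _) cb≈bc refl = begin
  c ++ b      ≡⟨ cong₂ _++_ (trans c≡₁ (++-identityʳ p₁)) b≡₁ ⟩
  p₁ ++ q₁    ≡⟨ swap-reducts C₁ C₂ cb≈bc ⟩
  p₂ ++ q₂    ≡⟨ cong₂ _++_ (trans b≡₂ (++-identityʳ p₂)) c≡₂ ⟨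
  b ++ c      ∎
  where open ≡-Reasoning

¬partial-overlap : {c b : Expr k} → CyclicallyReduced c →
  (C₁ : Cancellation c b) (C₂ : Cancellation b c) → c ++ b ≈ b ++ c →
  let open Cancellation C₁ in prefix ≢ [] → cancelled ≢ [] → suffix ≢ [] → ⊥
¬partial-overlap _ (mkCancellation [] _ _ _ _ _) _ _ p₁≢[] _ _ = p₁≢[] refl
¬partial-overlap _ (mkCancellation _ _ [] _ _ _) _ _ _ _ q₁≢[] = q₁≢[] refl
¬partial-overlap _ C₁@(mkCancellation (_ ∷ _) _ (_ ∷ _) _ _ _) C₂@(mkCancellation [] _ _ _ _ _) cb≈bc _ _ _
  with () ← swap-prefix-length C₁ C₂ cb≈bc
¬partial-overlap {c = c} c-cyclic
  C₁@(mkCancellation (h ∷ p₁) t₁ (_ ∷ _) c≡₁ b≡₁ _) C₂@(mkCancellation (h₂ ∷ _) _ _ b≡₂ _ _) cb≈bc _ t₁≢[] _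
  with initLast t₁ | swap-reducts C₁ C₂ cb≈bc
... | [] | _ = t₁≢[] refl
... | t ∷ʳ′ j | same = ¬noCancel-invLetter j (subst (NoCancel j) h≡j⁻¹ (cyclicallyReduced-wrap c-cyclic c≡))
  where
  h≡j⁻¹ : h ≡ invLetter j
  h≡j⁻¹ = trans (∷-injectiveˡ same)
    (∷-injectiveˡ (trans (sym b≡₂) (trans b≡₁ (cong (_++ _) (⊖-++ t (j ∷ []))))))
  c≡ : c ≡ h ∷ (p₁ ++ t) ∷ʳ j
  c≡ = trans c≡₁ (cong (h ∷_) (sym (++-assoc p₁ t (j ∷ []))))

module _ (S : Subset k) {c : Expr k} (c-cyclic : CyclicallyReduced c) (c≢[] : c ≢ [])
         (φc≈[] : restrict S c ≈ []) where

  -- Write c·b = p₁t₁·t₁⁻¹q₁ and b·c = p₂t₂·t₂⁻¹q₂; both reduce to the same word and |t₁| = |t₂|.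
  -- If q₁ = [] then c = p₁b⁻¹ = b⁻¹p₁ commutes with b⁻¹ as a word; if t₁ = [] then c and b
  -- commute as words; if p₁ = [] then b = c⁻¹q₁ with q₁ shorter and commuting with c; otherwise
  -- the first letter of c would be the inverse of its last.
  restrict-centralizer-acc : {b : Expr k} → Acc _<_ (length b) → Reduced b → c ++ b ≈ b ++ c → restrict S b ≈ []
  restrict-centralizer-acc {b} (acc rec) rb cb≈bc
    with cancellation (proj₁ c-cyclic) rb | cancellation rb (proj₁ c-cyclic)
  ... | C₁@(mkCancellation _ _ [] _ _ _) | C₂ =
    restrict-⊖-≈[] S b (restrict-commuting-word S c≢[] (no-suffix⇒⊖-commute C₁ C₂ cb≈bc refl) φc≈[])
  ... | C₁@(mkCancellation _ [] _ _ _ _) | C₂ =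
    restrict-commuting-word S c≢[] (no-cancellation⇒commute C₁ C₂ cb≈bc refl) φc≈[]
  ... | C₁@(mkCancellation (_ ∷ _) (_ ∷ _) (_ ∷ _) _ _ _) | C₂ =
    ⊥-elim (¬partial-overlap c-cyclic C₁ C₂ cb≈bc (λ ()) (λ ()) (λ ()))
  ... | C₁@(mkCancellation [] t₁@(_ ∷ _) q₁ c≡₁ b≡₁ r₁) | _ = begin
    restrict S b                          ≡⟨ cong (restrict S) (trans b≡₁ (cong (λ x → ⊖ x ++ q₁) (sym c≡₁))) ⟩
    restrict S (⊖ c ++ q₁)                ≡⟨ restrict-++ S (⊖ c) q₁ ⟩
    restrict S (⊖ c) ++ restrict S q₁     ≡⟨ cong (_++ restrict S q₁) (restrict-⊖ S c) ⟩
    ⊖ restrict S c ++ restrict S q₁       ≈⟨ ++-cong (⊖-cong φc≈[]) φq₁≈[] ⟩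
    []                                    ∎
    where
    open ≈-Reasoning
    rq₁ : Reduced q₁
    rq₁ = linked-++⁻ʳ (⊖ t₁) (subst Reduced b≡₁ rb)
    |q₁|<|b| : length q₁ < length b
    |q₁|<|b| = subst (length q₁ <_) (sym (Cancellation.length-y C₁)) (s≤s (m≤n+m (length q₁) _))
    cb≈q₁ : c ++ b ≈ q₁
    cb≈q₁ = mk≈ (trans r₁ (sym (reduced⇒reduce≡ rq₁)))
    cq₁≈q₁c : c ++ q₁ ≈ q₁ ++ c
    cq₁≈q₁c = begin
      c ++ q₁          ≈⟨ ++-congˡ c cb≈q₁ ⟨
      c ++ c ++ b      ≈⟨ ++-congˡ c cb≈bc ⟩
      c ++ b ++ c      ≡⟨ ++-assoc c b c ⟨
      (c ++ b) ++ c    ≈⟨ ++-congʳ c cb≈q₁ ⟩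
      q₁ ++ c          ∎
    φq₁≈[] : restrict S q₁ ≈ []
    φq₁≈[] = restrict-centralizer-acc (rec |q₁|<|b|) rq₁ cq₁≈q₁c

  restrict-centralizer : {b : Expr k} → Reduced b → c ++ b ≈ b ++ c → restrict S b ≈ []
  restrict-centralizer = restrict-centralizer-acc (<-wellFounded _)

restrict-commuting : (S : Subset k) {a b : Expr k} → ¬ a ≈ [] → a ++ b ≈ b ++ a →
  restrict S a ≈ [] → restrict S b ≈ []
restrict-commuting {k} S {a} {b} a≉[] ab≈ba φa≈[] with ≈[]⊎cyclicConjugate a
... | inj₁ a≈[] = contradiction a≈[] a≉[]
... | inj₂ C = conj-≈ε⇒≈ε (φ u) (begin
  conj (φ u) (φ b)    ≡⟨ restrict-conj S u b ⟨
  φ b′                ≈⟨ restrict-reduce S b′ ⟩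
  φ (reduce b′)       ≈⟨ restrict-centralizer S core-cyclic core≢[] φcore≈[] (reduce-reduced b′) core-commutes ⟩
  []                  ∎)
  where
  open CyclicConjugate C renaming (conjugator to u)
  open ≈-Reasoning
  φ : Expr k → Expr k
  φ = restrict S
  b′ : Expr k
  b′ = conj u b
  φcore≈[] : φ core ≈ []
  φcore≈[] = begin
    φ core              ≈⟨ restrict-cong S (core≈conj a C) ⟩
    φ (conj u a)        ≡⟨ restrict-conj S u a ⟩
    conj (φ u) (φ a)    ≈⟨ conj-cong (φ u) {φ a} φa≈[] ⟩
    conj (φ u) []       ≈⟨ conj-ε (φ u) ⟩
    []                  ∎
  core-commutes : core ++ reduce b′ ≈ reduce b′ ++ core
  core-commutes = begin
    core ++ reduce b′      ≈⟨ ++-cong (core≈conj a C) (reduce-≈ b′) ⟩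
    conj u a ++ b′         ≈⟨ conj-commute u ab≈ba ⟩
    b′ ++ conj u a         ≈⟨ ++-cong (reduce-≈ b′) (core≈conj a C) ⟨
    reduce b′ ++ core      ∎

-- Specifications

hang≢fall : hang ≢ fall
hang≢fall ()

≡fall-⇔⇒≡ : {o₁ o₂ : Outcome} → (o₁ ≡ fall ⇔ o₂ ≡ fall) → o₁ ≡ o₂
≡fall-⇔⇒≡ {hang} {hang} _ = refl
≡fall-⇔⇒≡ {hang} {fall} o₁⇔o₂ = Equivalence.from o₁⇔o₂ refl
≡fall-⇔⇒≡ {fall} {hang} o₁⇔o₂ = sym (Equivalence.to o₁⇔o₂ refl)
≡fall-⇔⇒≡ {fall} {fall} _ = refl

∧O-≡fall : {o₁ o₂ : Outcome} → o₁ ∧O o₂ ≡ fall → o₁ ≡ fall × o₂ ≡ fall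
∧O-≡fall {fall} o₂≡fall = refl , o₂≡fall

∨O-≡fall : {o₁ o₂ : Outcome} → o₁ ∨O o₂ ≡ fall → o₁ ≡ fall ⊎ o₂ ≡ fall
∨O-≡fall {hang} o₂≡fall = inj₂ o₂≡fall
∨O-≡fall {fall} _ = inj₁ refl

Separated : (g₁ g₂ : Subset k → Outcome) → Set
Separated g₁ g₂ = ∀ S → g₁ S ≡ hang → g₂ S ≡ hang → SeparateAbove g₁ g₂ S

agree-above⇒fall : {g₁ g₂ : Subset k → Outcome} → Separated g₁ g₂ →
  {S : Subset k} → (∀ {S′} → S ⊆ S′ → g₁ S′ ≡ g₂ S′) → g₁ S ≡ fall
agree-above⇒fall {g₁ = g₁} separated {S} agree with g₁ S in g₁S≡hang
... | fall = refl
... | hang with separated S g₁S≡hang (trans (sym (agree ⊆-refl)) g₁S≡hang)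
...   | S′ , S⊆S′ , g₁S′≢g₂S′ = contradiction (agree S⊆S′) g₁S′≢g₂S′

solves⇒≈[]⇔≡fall : (h : Expr k) {g : Subset k → Outcome} → Solves h g → ∀ S → restrict S h ≈ [] ⇔ g S ≡ fall
solves⇒≈[]⇔≡fall h solves S =
  mk⇔ (λ φh≈[] → Equivalence.to (solves S) (reduce-≡ φh≈[])) (λ gS≡fall → mk≈ (Equivalence.from (solves S) gS≡fall))

solves-agree : (h₁ h₂ : Expr k) {g₁ g₂ : Subset k → Outcome} → Solves h₁ g₁ → Solves h₂ g₂ →
  ∀ S → (restrict S h₁ ≈ [] ⇔ restrict S h₂ ≈ []) → g₁ S ≡ g₂ S
solves-agree h₁ h₂ solves₁ solves₂ S φh₁⇔φh₂ = ≡fall-⇔⇒≡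
  (⇔-trans (⇔-sym (solves⇒≈[]⇔≡fall h₁ solves₁ S)) (⇔-trans φh₁⇔φh₂ (solves⇒≈[]⇔≡fall h₂ solves₂ S)))

solves-∧ : (h₁ h₂ : Expr k) {g₁ g₂ : Subset k → Outcome} → Solves h₁ g₁ → Solves h₂ g₂ → Separated g₁ g₂ →
  Solves (h₁ ⊕ h₂) (g₁ ∧f g₂)
solves-∧ h₁ h₂ {g₁} {g₂} solves₁ solves₂ separated S = mk⇔ to from
  where
  to : IsZero (restrict S (h₁ ⊕ h₂)) → g₁ S ∧O g₂ S ≡ fall
  to φh≈[] = cong₂ _∧O_ g₁S≡fall (trans (sym (agree ⊆-refl)) g₁S≡fall)
    where
    agree : ∀ {S′} → S ⊆ S′ → g₁ S′ ≡ g₂ S′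
    agree {S′} S⊆S′ = solves-agree h₁ h₂ solves₁ solves₂ S′
      (x∙y≈ε⇒x≈ε⇔y≈ε (restrict S′ h₁) (restrict S′ h₂) (subst (_≈ []) (restrict-++ S′ h₁ h₂) φ′h≈[]))
      where
      φ′h≈[] : restrict S′ (h₁ ⊕ h₂) ≈ []
      φ′h≈[] = restrict-≈[]-⊆ S⊆S′ (h₁ ⊕ h₂) (mk≈ φh≈[])
    g₁S≡fall : g₁ S ≡ fall
    g₁S≡fall = agree-above⇒fall separated agree
  from : g₁ S ∧O g₂ S ≡ fall → IsZero (restrict S (h₁ ⊕ h₂))
  from g≡fall with ∧O-≡fall g≡fall
  ... | g₁S≡fall , g₂S≡fall = reduce-≡ (subst (_≈ []) (sym (restrict-++ S h₁ h₂)) (++-cong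
    (Equivalence.from (solves⇒≈[]⇔≡fall h₁ solves₁ S) g₁S≡fall)
    (Equivalence.from (solves⇒≈[]⇔≡fall h₂ solves₂ S) g₂S≡fall)))

solves-∨ : (h₁ h₂ : Expr k) {g₁ g₂ : Subset k → Outcome} → Solves h₁ g₁ → Solves h₂ g₂ → Separated g₁ g₂ →
  Solves (comm h₁ h₂) (g₁ ∨f g₂)
solves-∨ h₁ h₂ {g₁} {g₂} solves₁ solves₂ separated S = mk⇔ to from
  where
  φh₁⇔ : restrict S h₁ ≈ [] ⇔ g₁ S ≡ fall
  φh₁⇔ = solves⇒≈[]⇔≡fall h₁ solves₁ S
  φh₂⇔ : restrict S h₂ ≈ [] ⇔ g₂ S ≡ fall
  φh₂⇔ = solves⇒≈[]⇔≡fall h₂ solves₂ S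
  to : IsZero (restrict S (comm h₁ h₂)) → g₁ S ∨O g₂ S ≡ fall
  to φ[h₁,h₂]≈[] with g₁ S in g₁S≡hang | g₂ S in g₂S≡hang
  ... | fall | _ = refl
  ... | hang | fall = refl
  ... | hang | hang = ⊥-elim (hang≢fall (trans (sym g₁S≡hang) (agree-above⇒fall separated agree)))
    where
    φh₁φh₂≈φh₂φh₁ : restrict S h₁ ++ restrict S h₂ ≈ restrict S h₂ ++ restrict S h₁
    φh₁φh₂≈φh₂φh₁ = [x,y]≈ε⇒x∙y≈y∙x (restrict S h₁) (restrict S h₂)
      (subst (_≈ []) (restrict-comm S h₁ h₂) (mk≈ φ[h₁,h₂]≈[]))
    φh₁≉[] : ¬ restrict S h₁ ≈ []
    φh₁≉[] φh₁≈[] = hang≢fall (trans (sym g₁S≡hang) (Equivalence.to φh₁⇔ φh₁≈[]))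
    φh₂≉[] : ¬ restrict S h₂ ≈ []
    φh₂≉[] φh₂≈[] = hang≢fall (trans (sym g₂S≡hang) (Equivalence.to φh₂⇔ φh₂≈[]))
    agree : ∀ {S′} → S ⊆ S′ → g₁ S′ ≡ g₂ S′
    agree {S′} S⊆S′ = solves-agree h₁ h₂ solves₁ solves₂ S′
      (subst₂ (λ x y → x ≈ [] ⇔ y ≈ []) (restrict-⊆ S⊆S′ h₁) (restrict-⊆ S⊆S′ h₂) (mk⇔
        (restrict-commuting S′ φh₁≉[] φh₁φh₂≈φh₂φh₁)
        (restrict-commuting S′ φh₂≉[] (≈.sym φh₁φh₂≈φh₂φh₁))))
  from : g₁ S ∨O g₂ S ≡ fall → IsZero (restrict S (comm h₁ h₂))
  from g≡fall = reduce-≡ (subst (_≈ []) (sym (restrict-comm S h₁ h₂)) ([φh₁,φh₂]≈[] (∨O-≡fall g≡fall)))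
    where
    [φh₁,φh₂]≈[] : g₁ S ≡ fall ⊎ g₂ S ≡ fall → [ restrict S h₁ , restrict S h₂ ] ≈ []
    [φh₁,φh₂]≈[] (inj₁ g₁S≡fall) = x≈ε⇒[x,y]≈ε (restrict S h₂) (Equivalence.from φh₁⇔ g₁S≡fall)
    [φh₁,φh₂]≈[] (inj₂ g₂S≡fall) = y≈ε⇒[x,y]≈ε (restrict S h₁) (Equivalence.from φh₂⇔ g₂S≡fall)

lemma3p2 : (n : ℕ) (g₁ g₂ : Spec n) (h₁ h₂ : Expr n)
    → Solves h₁ (f g₁) → Solves h₂ (f g₂)
    → (∀ S → f g₁ S ≡ hang → f g₂ S ≡ hang → SeparateAbove (f g₁) (f g₂) S)
    → Solves (h₁ ⊕ h₂) (f g₁ ∧f f g₂) × Solves (comm h₁ h₂) (f g₁ ∨f f g₂)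
lemma3p2 n g₁ g₂ h₁ h₂ solves₁ solves₂ separated =
  solves-∧ h₁ h₂ solves₁ solves₂ separated , solves-∨ h₁ h₂ solves₁ solves₂ separated
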